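{- There is an absolute constant $C>0$ such that for every positive integer $n$ there is a $3$-graph $G$ on $n$ vertices with $\left|\delta_1(G) - \frac{1}{2}\binom{n}{2}\right| \le Cn$ (that is, $\delta_1(G) = \frac12\binom{n}{2} - O(n)$) that does not contain a spanning component.
   Context: A $3$-graph $G$ consists of a vertex set $V(G)$ and a set $E(G)$ of $3$-element subsets of $V(G)$ (edges). The minimum (vertex) degree $\delta_1(G)$ is the largest integer $m$ such that every vertex lies in at least $m$ edges. The line graph $L(G)$ is the graph on vertex set $E(G)$ in which $e,f$ are adjacent whenever $|e\cap f| = 2$. A subgraph of $G$ is (tightly) connected if it has no isolated vertices and its edges induce a connected subgraph of $L(G)$. A (tight) component is an edge-maximal connected subgraph. A component is spanning if it contains all vertices of $G$. -}

module Defs where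

open import Data.Nat using (ℕ; _+_; _*_; _≤_)
open import Data.Fin using (Fin; _<?_)
open import Data.Bool using (Bool; true; false; if_then_else_)
open import Data.List using (List; map; allFin)
open import Data.Nat.ListAction using (sum)
open import Data.Product using (Σ; ∃; _×_; _,_)
open import Data.Sum using (_⊎_)
open import Relation.Binary.PropositionalEquality using (_≡_; _≢_)
open import Relation.Nullary using (¬_; does)

record ThreeGraph (n : ℕ) : Set where
  field
    edge      : Fin n → Fin n → Fin n → Bool
    sym₁₂     : ∀ a b c → edge a b c ≡ edge b a c
    sym₂₃     : ∀ a b c → edge a b c ≡ edge a c b
    distinct₁ : ∀ a c → edge a a c ≡ false
    distinct₂ : ∀ a b → edge a b b ≡ false
    distinct₃ : ∀ a b → edge a b a ≡ false
open ThreeGraph public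

degree : ∀ {n} → ThreeGraph n → Fin n → ℕ
degree {n} G v =
  sum (map (λ x → sum (map (λ y →
    if does (x <? y) then (if edge G v x y then 1 else 0) else 0)
    (allFin n))) (allFin n))

IsMinDegree : ∀ {n} → ThreeGraph n → ℕ → Set
IsMinDegree {n} G m =
  (∀ v → m ≤ degree G v) × (∀ m' → (∀ v → m' ≤ degree G v) → m' ≤ m)

-- edges of G, as (ordered representatives of) triples
Triple : ℕ → Set
Triple n = Fin n × Fin n × Fin n

IsEdge : ∀ {n} → ThreeGraph n → Triple n → Set
IsEdge G (a , b , c) = edge G a b c ≡ true

_∈ₜ_ : ∀ {n} → Fin n → Triple n → Set
v ∈ₜ (a , b , c) = v ≡ a ⊎ v ≡ b ⊎ v ≡ c

-- |e ∩ f| = 2 (for 3-sets e, f): two distinct common vertices, and e ≠ f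
Adjacent : ∀ {n} → Triple n → Triple n → Set
Adjacent {n} e f =
  (Σ (Fin n) λ u → Σ (Fin n) λ w → u ≢ w × u ∈ₜ e × u ∈ₜ f × w ∈ₜ e × w ∈ₜ f)
  × (Σ (Fin n) λ x → x ∈ₜ e × ¬ (x ∈ₜ f))

data TightlyConnected {n} (G : ThreeGraph n) : Triple n → Triple n → Set where
  here : ∀ {e} → IsEdge G e → TightlyConnected G e e
  step : ∀ {e f g} → TightlyConnected G e f → IsEdge G g → Adjacent f g →
         TightlyConnected G e g

HasSpanningComponent : ∀ {n} → ThreeGraph n → Set
HasSpanningComponent {n} G =
  Σ (Triple n) λ e → IsEdge G e ×
    (∀ (v : Fin n) → Σ (Triple n) λ f → TightlyConnected G e f × v ∈ₜ f)

{-# OPTIONS --safe #-}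
-- Split the vertices into an apex z, a core C of size s and a rim U, and let
-- W = {z} ∪ C.  The edges are the triples inside W and the triples avoiding z
-- with at most one vertex in W.  An edge of the second kind meets W in at most
-- one vertex, so it never shares two vertices with an edge of the first kind:
-- every tight component uses edges of one kind only, and so misses either the
-- rim or the apex.  The apex has degree (s choose 2), core vertices have at
-- least that, and a rim vertex has degree (n-2 choose 2) - (s choose 2).
-- Taking s largest with 2 (s choose 2) ≤ (n-2 choose 2) makes the minimum
-- degree (s choose 2) = ½ (n choose 2) - O(n).
module Submission where

open import Defs
import Data.Bool as Bool
open import Data.Bool using (Bool; true; false; _∧_; _∨_; not; if_then_else_; T)
open import Data.Bool.Properties using (∧-comm; ∧-zeroʳ; ∧-identityʳ; ∨-identityʳ; T-≡; T-∧; T-∨; ⇔→≡; ¬-not)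
open import Data.Empty using (⊥-elim)
open import Data.Fin as Fin using (Fin; zero; suc; toℕ; _<?_)
open import Data.Fin.Properties using (_≟_; <⇒≢)
open import Data.List using (map; tabulate; allFin)
open import Data.Nat as ℕ using (ℕ; zero; suc; pred; _+_; _*_; _≤_; _<_; z≤n; s≤s)
open import Data.Nat.Tactic.RingSolver using (solve-∀)
open import Data.Nat.Combinatorics using (_C_; nC1≡n; nCk+nC[k+1]≡[n+1]C[k+1])
open import Data.Nat.ListAction using () renaming (sum to sumᴸ)
open import Data.Nat.Properties as ℕ using (+-0-commutativeMonoid; +-comm; m≤n+m; ≤-reflexive; <ᵇ⇒<)
open import Data.Product using (Σ; _×_; _,_; proj₂)
open import Data.Sum using (_⊎_; inj₁; inj₂; map₂)
open import Function using (_∘_; mk⇔; Equivalence)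
open import Relation.Binary.PropositionalEquality
open import Relation.Nullary using (¬_; does; yes; no; contradiction)
open import Relation.Unary using (Decidable)
open import Relation.Nullary.Decidable using (dec-true; dec-false; does-⇔)

open import Algebra.Properties.CommutativeMonoid.Sum +-0-commutativeMonoid
  using (sum; sum-cong-≗; ∑-distrib-+)

private variable
  n : ℕ

-- Counting over Fin n

sum-map-tabulate : ∀ {A : Set} (g : Fin n → A) (f : A → ℕ) →
                   sumᴸ (map f (tabulate g)) ≡ sum (f ∘ g)
sum-map-tabulate {zero}  g f = refl
sum-map-tabulate {suc n} g f = cong (f (g zero) +_) (sum-map-tabulate (g ∘ suc) f)

⟦_⟧ : Bool → ℕ
⟦ b ⟧ = if b then 1 else 0

count : (Fin n → Bool) → ℕ
count P = sum λ i → ⟦ P i ⟧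

count-+ : {P Q R : Fin n → Bool} → (∀ i → ⟦ P i ⟧ + ⟦ Q i ⟧ ≡ ⟦ R i ⟧) →
          count P + count Q ≡ count R
count-+ {P = P} {Q} h = trans (sym (∑-distrib-+ (λ i → ⟦ P i ⟧) (λ i → ⟦ Q i ⟧))) (sum-cong-≗ h)

⟦∖⟧ : ∀ x y → (T y → T x) → ⟦ x ∧ not y ⟧ + ⟦ y ⟧ ≡ ⟦ x ⟧
⟦∖⟧ true  false _   = refl
⟦∖⟧ false false _   = refl
⟦∖⟧ true  true  _   = refl
⟦∖⟧ false true  y⇒x = ⊥-elim (y⇒x _)

count-∖ : {P Q : Fin n → Bool} → (∀ i → T (Q i) → T (P i)) →
          count (λ i → P i ∧ not (Q i)) + count Q ≡ count P
count-∖ {P = P} {Q} Q⊆P = count-+ λ i → ⟦∖⟧ (P i) (Q i) (Q⊆P i)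

count-none : (P : Fin n → Bool) → (∀ i → ¬ T (P i)) → count P ≡ 0
count-none {zero}  _ _    = refl
count-none {suc n} P none with P zero in eq
... | true  = ⊥-elim (none zero (subst T (sym eq) _))
... | false = count-none (P ∘ suc) (none ∘ suc)

count-false : ∀ n → count {n} (λ _ → false) ≡ 0
count-false n = count-none {n} (λ _ → false) (λ _ ())

count-all : count {n} (λ _ → true) ≡ n
count-all {zero}  = refl
count-all {suc n} = cong suc count-all

count-≟ : (r : Fin n) → count (λ i → does (r ≟ i)) ≡ 1
count-≟ {suc n} zero    = cong suc (count-false n)
count-≟         (suc r) = count-≟ r

count-remove : {P : Fin n → Bool} (r : Fin n) → T (P r) →
               count (λ i → P i ∧ not (does (r ≟ i))) + 1 ≡ count P
count-remove {P = P} r Pr = begin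
  count (λ i → P i ∧ not (does (r ≟ i))) + 1
    ≡⟨ cong (count (λ i → P i ∧ not (does (r ≟ i))) +_) (count-≟ r) ⟨
  count (λ i → P i ∧ not (does (r ≟ i))) + count (λ i → does (r ≟ i))
    ≡⟨ count-∖ r≟i⇒P ⟩
  count P ∎
  where
  open ≡-Reasoning
  r≟i⇒P : ∀ i → T (does (r ≟ i)) → T (P i)
  r≟i⇒P i _ with r ≟ i
  ... | yes refl = Pr

pairCount : (Fin n → Fin n → Bool) → ℕ
pairCount R = sum λ x → count λ y → does (x <? y) ∧ R x y

pairCount-suc : (R : Fin (suc n) → Fin (suc n) → Bool) →
  pairCount R ≡ count (R zero ∘ suc) + pairCount (λ i j → R (suc i) (suc j))
pairCount-suc R = refl

does<?⇒< : (x y : Fin n) → does (x <? y) ≡ true → x Fin.< y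
does<?⇒< x y lt = <ᵇ⇒< (toℕ x) (toℕ y) (Equivalence.from T-≡ lt)

pairCount-cong : {R S : Fin n → Fin n → Bool} → (∀ {x y} → x Fin.< y → R x y ≡ S x y) →
                 pairCount R ≡ pairCount S
pairCount-cong {R = R} {S} R≡S = sum-cong-≗ λ x → sum-cong-≗ λ y → term≡ x y
  where
  term≡ : ∀ x y → ⟦ does (x <? y) ∧ R x y ⟧ ≡ ⟦ does (x <? y) ∧ S x y ⟧
  term≡ x y with does (x <? y) in lt
  ... | true  = cong ⟦_⟧ (R≡S (does<?⇒< x y lt))
  ... | false = refl

pairCount-∖ : {R S : Fin n → Fin n → Bool} → (∀ {x y} → x Fin.< y → T (S x y) → T (R x y)) →
              pairCount (λ x y → R x y ∧ not (S x y)) + pairCount S ≡ pairCount R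
pairCount-∖ {R = R} {S} S⊆R =
  trans (sym (∑-distrib-+ (λ x → count λ y → does (x <? y) ∧ (R x y ∧ not (S x y)))
                          (λ x → count λ y → does (x <? y) ∧ S x y)))
        (sum-cong-≗ λ x → count-+ λ y → term x y)
  where
  term : ∀ x y → ⟦ does (x <? y) ∧ (R x y ∧ not (S x y)) ⟧ + ⟦ does (x <? y) ∧ S x y ⟧
                 ≡ ⟦ does (x <? y) ∧ R x y ⟧
  term x y with does (x <? y) in lt
  ... | true  = ⟦∖⟧ (R x y) (S x y) (S⊆R (does<?⇒< x y lt))
  ... | false = refl

suc-C₂ : ∀ c → suc c C 2 ≡ c + c C 2
suc-C₂ c = trans (sym (nCk+nC[k+1]≡[n+1]C[k+1] c 1)) (cong (_+ c C 2) (nC1≡n c))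

pairCount-both : (P : Fin n → Bool) → pairCount (λ x y → P x ∧ P y) ≡ count P C 2
pairCount-both {zero}  P = refl
pairCount-both {suc n} P with P zero
... | true  = trans (cong (count (P ∘ suc) +_) (pairCount-both (P ∘ suc)))
                    (sym (suc-C₂ (count (P ∘ suc))))
... | false = cong₂ _+_ (count-false n) (pairCount-both (P ∘ suc))

half≤complement : ∀ {c d M} → d + c ≡ M → 2 * c ≤ M → c ≤ d
half≤complement {c} {d} {M} d+c≡M 2c≤M = ℕ.+-cancelʳ-≤ c c d (begin
  c + c     ≡⟨ cong (c +_) (ℕ.+-identityʳ c) ⟨
  2 * c     ≤⟨ 2c≤M ⟩
  M         ≡⟨ d+c≡M ⟨
  d + c     ∎)
  where open ℕ.≤-Reasoning

∧-leftComm : ∀ x y z → x ∧ (y ∧ z) ≡ y ∧ (x ∧ z)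
∧-leftComm true  y z = refl
∧-leftComm false y z = sym (∧-zeroʳ y)

T-∧₃ : ∀ {x y z} → T (x ∧ y ∧ z) → T x × T y × T z
T-∧₃ xyz with Equivalence.to T-∧ xyz
... | x , yz = x , Equivalence.to T-∧ yz

T-not : ∀ {x} → T (not x) → ¬ T x
T-not {false} _ ()

T-∧-intro : ∀ {x y} → T x → T y → T (x ∧ y)
T-∧-intro x y = Equivalence.from T-∧ (x , y)

all₃ : (Fin n → Bool) → Fin n → Fin n → Fin n → Bool
all₃ P a b c = P a ∧ P b ∧ P c

pairwise₃ : (Fin n → Fin n → Bool) → Fin n → Fin n → Fin n → Bool
pairwise₃ R a b c = R a b ∧ R b c ∧ R a c

module _ (P : Fin n → Bool) where

  all₃-swap₁₂ : ∀ a b c → all₃ P a b c ≡ all₃ P b a c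
  all₃-swap₁₂ a b c = ∧-leftComm (P a) (P b) (P c)

  all₃-swap₂₃ : ∀ a b c → all₃ P a b c ≡ all₃ P a c b
  all₃-swap₂₃ a b c = cong (P a ∧_) (∧-comm (P b) (P c))

  all₃-∈ₜ : ∀ {a b c v} → T (all₃ P a b c) → v ∈ₜ (a , b , c) → T (P v)
  all₃-∈ₜ {a} {b} {c} abc v∈ with T-∧₃ {P a} {P b} {P c} abc | v∈
  ... | Pa , _  , _  | inj₁ refl        = Pa
  ... | _  , Pb , _  | inj₂ (inj₁ refl) = Pb
  ... | _  , _  , Pc | inj₂ (inj₂ refl) = Pc

module _ {R : Fin n → Fin n → Bool} (R-sym : ∀ x y → R x y ≡ R y x) where

  pairwise₃-swap₁₂ : ∀ a b c → pairwise₃ R a b c ≡ pairwise₃ R b a c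
  pairwise₃-swap₁₂ a b c = cong₂ _∧_ (R-sym a b) (∧-comm (R b c) (R a c))

  pairwise₃-swap₂₃ : ∀ a b c → pairwise₃ R a b c ≡ pairwise₃ R a c b
  pairwise₃-swap₂₃ a b c = begin
    R a b ∧ (R b c ∧ R a c) ≡⟨ cong (R a b ∧_) (∧-comm (R b c) (R a c)) ⟩
    R a b ∧ (R a c ∧ R b c) ≡⟨ ∧-leftComm (R a b) (R a c) (R b c) ⟩
    R a c ∧ (R a b ∧ R b c) ≡⟨ cong (R a c ∧_) (∧-comm (R a b) (R b c)) ⟩
    R a c ∧ (R b c ∧ R a b) ≡⟨ cong (λ x → R a c ∧ (x ∧ R a b)) (R-sym b c) ⟩
    R a c ∧ (R c b ∧ R a b) ∎
    where open ≡-Reasoning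

  pairwise₃-∈ₜ : ∀ {a b c u w} → T (pairwise₃ R a b c) →
                 u ∈ₜ (a , b , c) → w ∈ₜ (a , b , c) → u ≢ w → T (R u w)
  pairwise₃-∈ₜ {a} {b} {c} abc u∈ w∈ u≢w with T-∧₃ abc
  ... | ab , bc , ac = go u∈ w∈ u≢w
    where
    flip : ∀ {x y} → T (R x y) → T (R y x)
    flip {x} {y} = subst T (R-sym x y)
    go : ∀ {u w} → u ∈ₜ (a , b , c) → w ∈ₜ (a , b , c) → u ≢ w → T (R u w)
    go (inj₁ refl)        (inj₁ refl)        u≢w = ⊥-elim (u≢w refl)
    go (inj₁ refl)        (inj₂ (inj₁ refl)) _   = ab
    go (inj₁ refl)        (inj₂ (inj₂ refl)) _   = ac
    go (inj₂ (inj₁ refl)) (inj₁ refl)        _   = flip ab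
    go (inj₂ (inj₁ refl)) (inj₂ (inj₁ refl)) u≢w = ⊥-elim (u≢w refl)
    go (inj₂ (inj₁ refl)) (inj₂ (inj₂ refl)) _   = bc
    go (inj₂ (inj₂ refl)) (inj₁ refl)        _   = flip ac
    go (inj₂ (inj₂ refl)) (inj₂ (inj₁ refl)) _   = flip bc
    go (inj₂ (inj₂ refl)) (inj₂ (inj₂ refl)) u≢w = ⊥-elim (u≢w refl)

_≢ᵇ_ : Fin n → Fin n → Bool
x ≢ᵇ y = not (does (x ≟ y))

≢ᵇ-sym : ∀ (x y : Fin n) → x ≢ᵇ y ≡ y ≢ᵇ x
≢ᵇ-sym x y = cong not (does-⇔ (mk⇔ sym sym) (x ≟ y) (y ≟ x))

≢⇒T≢ᵇ : ∀ {x y : Fin n} → x ≢ y → T (x ≢ᵇ y)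
≢⇒T≢ᵇ {x = x} {y} x≢y rewrite dec-false (x ≟ y) x≢y = _

fromSymmetric : (P : Fin n → Fin n → Fin n → Bool) →
                (∀ a b c → P a b c ≡ P b a c) → (∀ a b c → P a b c ≡ P a c b) →
                ThreeGraph n
fromSymmetric {n} P P-swap₁₂ P-swap₂₃ = record
  { edge      = edge′
  ; sym₁₂     = λ a b c → cong₂ _∧_ (pairwise₃-swap₁₂ ≢ᵇ-sym a b c) (P-swap₁₂ a b c)
  ; sym₂₃     = λ a b c → cong₂ _∧_ (pairwise₃-swap₂₃ ≢ᵇ-sym a b c) (P-swap₂₃ a b c)
  ; distinct₁ = distinct₁′
  ; distinct₂ = distinct₂′
  ; distinct₃ = distinct₃′
  }
  where
  edge′ : Fin n → Fin n → Fin n → Bool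
  edge′ a b c = pairwise₃ _≢ᵇ_ a b c ∧ P a b c
  distinct₁′ : ∀ a c → edge′ a a c ≡ false
  distinct₁′ a c rewrite dec-true (a ≟ a) refl = refl
  distinct₂′ : ∀ a b → edge′ a b b ≡ false
  distinct₂′ a b rewrite dec-true (b ≟ b) refl = cong (_∧ P a b b) (∧-zeroʳ (a ≢ᵇ b))
  distinct₃′ : ∀ a b → edge′ a b a ≡ false
  distinct₃′ a b rewrite dec-true (a ≟ a) refl =
    cong (_∧ P a b a) (trans (cong (a ≢ᵇ b ∧_) (∧-zeroʳ (b ≢ᵇ a))) (∧-zeroʳ (a ≢ᵇ b)))

degree≡pairCount : (G : ThreeGraph n) (v : Fin n) → degree G v ≡ pairCount (edge G v)
degree≡pairCount {n} G v = begin
  sumᴸ (map (λ x → sumᴸ (map (term x) (allFin n))) (allFin n))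
    ≡⟨ sum-map-tabulate {n} (λ x → x) (λ x → sumᴸ (map (term x) (allFin n))) ⟩
  sum (λ x → sumᴸ (map (term x) (allFin n)))
    ≡⟨ sum-cong-≗ (λ x → trans (sum-map-tabulate (λ y → y) (term x)) (sum-cong-≗ (term≡ x))) ⟩
  pairCount (edge G v) ∎
  where
  open ≡-Reasoning
  term : Fin n → Fin n → ℕ
  term x y = if does (x <? y) then ⟦ edge G v x y ⟧ else 0
  term≡ : ∀ x y → term x y ≡ ⟦ does (x <? y) ∧ edge G v x y ⟧
  term≡ x y with does (x <? y)
  ... | true  = refl
  ... | false = refl

isMinDegree-attained : (G : ThreeGraph n) {δ : ℕ} (v₀ : Fin n) →
                       (∀ v → δ ≤ degree G v) → degree G v₀ ≡ δ → IsMinDegree G δ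
isMinDegree-attained G v₀ δ≤ deg-v₀ = δ≤ , λ δ′ δ′≤ → ℕ.≤-trans (δ′≤ v₀) (≤-reflexive deg-v₀)

no-spanning-on-one-vertex : (G : ThreeGraph 1) → ¬ HasSpanningComponent G
no-spanning-on-one-vertex G ((zero , zero , zero) , e∈G , _) =
  contradiction (trans (sym e∈G) (distinct₁ G zero zero)) λ ()

module _ (G : ThreeGraph n) where

  TightlyConnected⇒IsEdge : ∀ {e f} → TightlyConnected G e f → IsEdge G f
  TightlyConnected⇒IsEdge (here f∈G)     = f∈G
  TightlyConnected⇒IsEdge (step _ f∈G _) = f∈G

  module _ {A : Set} (c : Triple n → A)
           (c-adjacent : ∀ {f g} → IsEdge G f → IsEdge G g → Adjacent f g → c f ≡ c g) where

    constant-on-component : ∀ {e f} → TightlyConnected G e f → c e ≡ c f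
    constant-on-component (here _) = refl
    constant-on-component (step e⇝f g∈G f~g) =
      trans (constant-on-component e⇝f) (c-adjacent (TightlyConnected⇒IsEdge e⇝f) g∈G f~g)

    no-spanning-component : (missed : A → Fin n) → (∀ {f} → IsEdge G f → ¬ missed (c f) ∈ₜ f) →
                            ¬ HasSpanningComponent G
    no-spanning-component missed avoids (e , _ , covers) with covers (missed (c e))
    ... | f , e⇝f , missed∈f =
      avoids (TightlyConnected⇒IsEdge e⇝f)
             (subst (λ a → missed a ∈ₜ f) (constant-on-component e⇝f) missed∈f)

-- The construction

-- Vertex zero is the apex z, and vertex suc i lies in the core C iff core i.
module Construction {k : ℕ} (core : Fin k → Bool) where

  inW : Fin (suc k) → Bool
  inW zero    = true
  inW (suc i) = core i

  offApex : Fin (suc k) → Bool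
  offApex zero    = false
  offApex (suc _) = true

  notBothW : Fin (suc k) → Fin (suc k) → Bool
  notBothW x y = not (inW x ∧ inW y)

  notBothW-sym : ∀ x y → notBothW x y ≡ notBothW y x
  notBothW-sym x y = cong not (∧-comm (inW x) (inW y))

  insideW : Fin (suc k) → Fin (suc k) → Fin (suc k) → Bool
  insideW = all₃ inW

  allowed : Fin (suc k) → Fin (suc k) → Fin (suc k) → Bool
  allowed a b c = insideW a b c ∨ (all₃ offApex a b c ∧ pairwise₃ notBothW a b c)

  G : ThreeGraph (suc k)
  G = fromSymmetric allowed
    (λ a b c → cong₂ _∨_ (all₃-swap₁₂ inW a b c)
                 (cong₂ _∧_ (all₃-swap₁₂ offApex a b c) (pairwise₃-swap₁₂ notBothW-sym a b c)))
    (λ a b c → cong₂ _∨_ (all₃-swap₂₃ inW a b c)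
                 (cong₂ _∧_ (all₃-swap₂₃ offApex a b c) (pairwise₃-swap₂₃ notBothW-sym a b c)))

  edge-cases : ∀ {a b c} → T (edge G a b c) →
               T (insideW a b c) ⊎ (T (all₃ offApex a b c) × T (pairwise₃ notBothW a b c))
  edge-cases abc =
    map₂ (Equivalence.to T-∧) (Equivalence.to T-∨ (proj₂ (Equivalence.to T-∧ abc)))

  edge-insideW : ∀ {a b c} → T (pairwise₃ _≢ᵇ_ a b c) → T (insideW a b c) → T (edge G a b c)
  edge-insideW distinct inside = T-∧-intro distinct (Equivalence.from T-∨ (inj₁ inside))

  degree-apex : degree G zero ≡ count core C 2
  degree-apex = begin
    degree G zero
      ≡⟨ degree≡pairCount G zero ⟩
    pairCount (edge G zero)
      ≡⟨ pairCount-suc (edge G zero) ⟩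
    count (λ j → edge G zero zero (suc j)) + pairCount (λ i j → edge G zero (suc i) (suc j))
      ≡⟨ cong₂ _+_ (count-none _ (λ j → subst T (distinct₁ G zero (suc j))))
                   (pairCount-cong link) ⟩
    pairCount (λ i j → core i ∧ core j)
      ≡⟨ pairCount-both core ⟩
    count core C 2 ∎
    where
    open ≡-Reasoning
    link : ∀ {i j} → i Fin.< j → edge G zero (suc i) (suc j) ≡ core i ∧ core j
    link {i} {j} i<j rewrite dec-false (i ≟ j) (<⇒≢ i<j) = ∨-identityʳ (core i ∧ core j)

  degree-core : (r : Fin k) → core r ≡ true → count core C 2 ≤ degree G (suc r)
  degree-core r core-r≡true = begin
    count core C 2
      ≡⟨ cong (_C 2) (trans (+-comm 1 _) (count-remove r core-r)) ⟨
    count W′ C 2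
      ≡⟨ pairCount-both W′ ⟨
    pairCount (λ x y → W′ x ∧ W′ y)
      ≤⟨ m≤n+m _ (pairCount (λ x y → edge G (suc r) x y ∧ not (W′ x ∧ W′ y))) ⟩
    pairCount (λ x y → edge G (suc r) x y ∧ not (W′ x ∧ W′ y)) + pairCount (λ x y → W′ x ∧ W′ y)
      ≡⟨ pairCount-∖ link ⟩
    pairCount (edge G (suc r))
      ≡⟨ degree≡pairCount G (suc r) ⟨
    degree G (suc r) ∎
    where
    open ℕ.≤-Reasoning
    core-r : T (core r)
    core-r = Equivalence.from T-≡ core-r≡true
    W′ : Fin (suc k) → Bool
    W′ x = inW x ∧ (suc r ≢ᵇ x)
    link : ∀ {x y} → x Fin.< y → T (W′ x ∧ W′ y) → T (edge G (suc r) x y)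
    link {x} {y} x<y W′xy with Equivalence.to (T-∧ {W′ x}) W′xy
    ... | W′x , W′y with Equivalence.to (T-∧ {inW x}) W′x | Equivalence.to (T-∧ {inW y}) W′y
    ... | x∈W , r≢x | y∈W , r≢y = edge-insideW {suc r} {x} {y} distinct inside
      where
      distinct : T (pairwise₃ _≢ᵇ_ (suc r) x y)
      distinct = T-∧-intro {suc r ≢ᵇ x} r≢x (T-∧-intro {x ≢ᵇ y} (≢⇒T≢ᵇ (<⇒≢ x<y)) r≢y)
      inside : T (insideW (suc r) x y)
      inside = T-∧-intro {core r} core-r (T-∧-intro {inW x} x∈W y∈W)

  degree-rim : (r : Fin k) → core r ≡ false → degree G (suc r) + count core C 2 ≡ pred k C 2
  degree-rim r core-r≡false = begin
    degree G (suc r) + count core C 2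
      ≡⟨ cong (_+ count core C 2) (degree≡pairCount G (suc r)) ⟩
    pairCount (edge G (suc r)) + count core C 2
      ≡⟨ cong (_+ count core C 2) (pairCount-suc (edge G (suc r))) ⟩
    count (λ j → edge G (suc r) zero (suc j))
      + pairCount (λ i j → edge G (suc r) (suc i) (suc j)) + count core C 2
      ≡⟨ cong₂ (λ a b → a + b + count core C 2)
               (count-none _ apex-not-linked) (pairCount-cong link) ⟩
    pairCount link-of-r + count core C 2
      ≡⟨ cong (pairCount link-of-r +_) (pairCount-both core) ⟨
    pairCount link-of-r + pairCount (λ i j → core i ∧ core j)
      ≡⟨ pairCount-∖ core⊆others ⟩
    pairCount (λ i j → r ≢ᵇ i ∧ r ≢ᵇ j)
      ≡⟨ pairCount-both (r ≢ᵇ_) ⟩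
    count (r ≢ᵇ_) C 2
      ≡⟨ cong (λ c → pred c C 2) (trans (+-comm 1 _) (count-remove {P = λ _ → true} r _)) ⟩
    pred (count {k} (λ _ → true)) C 2
      ≡⟨ cong (λ c → pred c C 2) (count-all {k}) ⟩
    pred k C 2 ∎
    where
    open ≡-Reasoning
    link-of-r : Fin k → Fin k → Bool
    link-of-r i j = (r ≢ᵇ i ∧ r ≢ᵇ j) ∧ not (core i ∧ core j)
    apex-not-linked : ∀ j → ¬ T (edge G (suc r) zero (suc j))
    apex-not-linked j e with edge-cases {suc r} {zero} {suc j} e
    ... | inj₁ inside    =
      subst T core-r≡false (all₃-∈ₜ inW {suc r} {zero} {suc j} inside (inj₁ refl))
    ... | inj₂ (off , _) = all₃-∈ₜ offApex {suc r} {zero} {suc j} off (inj₂ (inj₁ refl))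
    link : ∀ {i j} → i Fin.< j → edge G (suc r) (suc i) (suc j) ≡ link-of-r i j
    link {i} {j} i<j rewrite dec-false (i ≟ j) (<⇒≢ i<j) | core-r≡false =
      cong ((r ≢ᵇ i ∧ r ≢ᵇ j) ∧_) (∧-identityʳ (not (core i ∧ core j)))
    core⊆others : ∀ {i j} → i Fin.< j → T (core i ∧ core j) → T (r ≢ᵇ i ∧ r ≢ᵇ j)
    core⊆others {i} {j} _ core-ij with Equivalence.to (T-∧ {core i}) core-ij
    ... | core-i , core-j = T-∧-intro {r ≢ᵇ i} (≢⇒T≢ᵇ (r≢ core-i)) (≢⇒T≢ᵇ (r≢ core-j))
      where
      r≢ : ∀ {i} → T (core i) → r ≢ i
      r≢ core-i refl = subst T core-r≡false core-i

  min-degree : 2 * (count core C 2) ≤ pred k C 2 → ∀ v → count core C 2 ≤ degree G v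
  min-degree _ zero = ≤-reflexive (sym degree-apex)
  min-degree 2c≤M (suc r) with core r Bool.≟ true
  ... | yes core-r = degree-core r core-r
  ... | no  rim-r  = half≤complement {count core C 2} (degree-rim r (¬-not rim-r)) 2c≤M

  edge-with-two-in-W : ∀ {a b c u w} → T (edge G a b c) →
                       u ∈ₜ (a , b , c) → w ∈ₜ (a , b , c) → u ≢ w → T (inW u) → T (inW w) →
                       T (insideW a b c)
  edge-with-two-in-W {a} {b} {c} abc u∈ w∈ u≢w u∈W w∈W with edge-cases {a} {b} {c} abc
  ... | inj₁ inside        = inside
  ... | inj₂ (_ , notBoth) =
    ⊥-elim (T-not (pairwise₃-∈ₜ notBothW-sym notBoth u∈ w∈ u≢w) (T-∧-intro u∈W w∈W))

  insideWₜ : Triple (suc k) → Bool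
  insideWₜ (a , b , c) = insideW a b c

  insideW-adjacent : ∀ {f g} → IsEdge G f → IsEdge G g → Adjacent f g → insideWₜ f ≡ insideWₜ g
  insideW-adjacent {f} {g} f∈G g∈G ((u , w , u≢w , u∈f , u∈g , w∈f , w∈g) , _) =
    ⇔→≡ (mk⇔ (spread f g g∈G u∈f w∈f u∈g w∈g) (spread g f f∈G u∈g w∈g u∈f w∈f))
    where
    spread : ∀ f g → IsEdge G g → u ∈ₜ f → w ∈ₜ f → u ∈ₜ g → w ∈ₜ g →
             insideWₜ f ≡ true → insideWₜ g ≡ true
    spread (a , b , c) (a′ , b′ , c′) g∈G u∈f w∈f u∈g w∈g f⊆W =
      Equivalence.to T-≡
        (edge-with-two-in-W {a′} {b′} {c′} (Equivalence.from T-≡ g∈G) u∈g w∈g u≢w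
           (all₃-∈ₜ inW {a} {b} {c} (Equivalence.from T-≡ f⊆W) u∈f)
           (all₃-∈ₜ inW {a} {b} {c} (Equivalence.from T-≡ f⊆W) w∈f))

  no-spanning : (r : Fin k) → core r ≡ false → ¬ HasSpanningComponent G
  no-spanning r core-r≡false = no-spanning-component G insideWₜ insideW-adjacent missed avoids
    where
    missed : Bool → Fin (suc k)
    missed true  = suc r
    missed false = zero
    insideW-avoids-rim : ∀ f → insideWₜ f ≡ true → ¬ suc r ∈ₜ f
    insideW-avoids-rim (a , b , c) f⊆W r∈f =
      subst T core-r≡false (all₃-∈ₜ inW {a} {b} {c} (Equivalence.from T-≡ f⊆W) r∈f)
    outsideW-avoids-apex : ∀ f → IsEdge G f → insideWₜ f ≡ false → ¬ zero ∈ₜ f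
    outsideW-avoids-apex (a , b , c) f∈G f⊈W
      with edge-cases {a} {b} {c} (Equivalence.from T-≡ f∈G)
    ... | inj₁ inside    = ⊥-elim (subst T f⊈W inside)
    ... | inj₂ (off , _) = all₃-∈ₜ offApex {a} {b} {c} off
    avoids : ∀ {f} → IsEdge G f → ¬ missed (insideWₜ f) ∈ₜ f
    avoids {f} f∈G = by-side (insideWₜ f) refl
      where
      by-side : ∀ b → insideWₜ f ≡ b → ¬ missed b ∈ₜ f
      by-side true  f⊆W = insideW-avoids-rim f f⊆W
      by-side false f⊈W = outsideW-avoids-apex f f∈G f⊈W

-- Choosing the size of the core

count-below : ∀ {s} → s ≤ n → count {n} (λ i → does (toℕ i ℕ.<? s)) ≡ s
count-below {zero}  {zero}  _         = refl
count-below {suc n} {zero}  _         = count-false (suc n)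
count-below {suc n} {suc s} (s≤s s≤n) = cong suc (count-below s≤n)

largest-below : (P : ℕ → Set) → Decidable P → P 0 →
                ∀ j → Σ ℕ λ s → s ≤ j × P s × (s < j → ¬ P (suc s))
largest-below P P? P0 zero = zero , z≤n , P0 , λ ()
largest-below P P? P0 (suc j) with P? (suc j)
... | yes Pj = suc j , ℕ.≤-refl , Pj , λ j<j → contradiction j<j (ℕ.<-irrefl refl)
... | no ¬Pj with largest-below P P? P0 j
...   | s , s≤j , Ps , maximal = s , ℕ.m≤n⇒m≤1+n s≤j , Ps , maximal′
  where
  maximal′ : s < suc j → ¬ P (suc s)
  maximal′ (s≤s s≤j) with ℕ.m≤n⇒m<n∨m≡n s≤j
  ... | inj₁ s<j  = maximal s<j
  ... | inj₂ refl = ¬Pj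

core-size : ∀ m → Σ ℕ λ s → s ≤ m × 2 * (s C 2) ≤ m C 2 × m C 2 ≤ 2 * (s C 2) + 2 * m
core-size m with largest-below (λ s → 2 * (s C 2) ≤ m C 2) (λ s → 2 * (s C 2) ℕ.≤? m C 2) z≤n m
... | s , s≤m , lower , maximal = s , s≤m , lower , upper
  where
  open ℕ.≤-Reasoning
  upper : m C 2 ≤ 2 * (s C 2) + 2 * m
  upper with ℕ.m≤n⇒m<n∨m≡n s≤m
  ... | inj₂ refl = ℕ.≤-trans (ℕ.m≤n*m (m C 2) 2) (ℕ.m≤m+n _ _)
  ... | inj₁ s<m  = begin
    m C 2                   ≤⟨ ℕ.<⇒≤ (ℕ.≰⇒> (maximal s<m)) ⟩
    2 * (suc s C 2)         ≡⟨ cong (2 *_) (suc-C₂ s) ⟩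
    2 * (s + s C 2)         ≡⟨ ℕ.*-distribˡ-+ 2 s (s C 2) ⟩
    2 * s + 2 * (s C 2)     ≡⟨ +-comm (2 * s) _ ⟩
    2 * (s C 2) + 2 * s     ≤⟨ ℕ.+-monoʳ-≤ (2 * (s C 2)) (ℕ.*-monoʳ-≤ 2 s≤m) ⟩
    2 * (s C 2) + 2 * m     ∎

-- Vertex 1 is kept out of the core, so that the rim is never empty.
coreOfSize : ∀ {m} → ℕ → Fin (suc m) → Bool
coreOfSize s zero    = false
coreOfSize s (suc i) = does (toℕ i ℕ.<? s)

construction-on : ∀ m → Σ (ThreeGraph (2 + m)) λ G → Σ ℕ λ δ → IsMinDegree G δ ×
                  2 * δ ≤ m C 2 × m C 2 ≤ 2 * δ + 2 * m × ¬ HasSpanningComponent G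
construction-on m with core-size m
... | s , s≤m , lower , upper =
  G , count core C 2 , isMinDegree-attained G zero (min-degree lower′) degree-apex ,
  lower′ , upper′ , no-spanning zero refl
  where
  core : Fin (suc m) → Bool
  core = coreOfSize s
  open Construction core
  |core|≡s : count core ≡ s
  |core|≡s = count-below s≤m
  lower′ : 2 * (count core C 2) ≤ m C 2
  lower′ = subst (λ c → 2 * (c C 2) ≤ m C 2) (sym |core|≡s) lower
  upper′ : m C 2 ≤ 2 * (count core C 2) + 2 * m
  upper′ = subst (λ c → m C 2 ≤ 2 * (c C 2) + 2 * m) (sym |core|≡s) upper

within-linear-window : ∀ m δ → 2 * δ ≤ m C 2 → m C 2 ≤ 2 * δ + 2 * m →
  2 * δ ≤ (2 + m) C 2 + 2 * 2 * (2 + m) × (2 + m) C 2 ≤ 2 * δ + 2 * 2 * (2 + m)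
within-linear-window m δ lower upper =
  ℕ.≤-trans lower (ℕ.≤-trans m≤n (ℕ.m≤m+n _ _)) , n≤
  where
  open ℕ.≤-Reasoning
  nC2 : (2 + m) C 2 ≡ suc m + (m + m C 2)
  nC2 = trans (suc-C₂ (suc m)) (cong (suc m +_) (suc-C₂ m))
  m≤n : m C 2 ≤ (2 + m) C 2
  m≤n = ℕ.≤-trans (m≤n+m _ m) (ℕ.≤-trans (m≤n+m _ (suc m)) (≤-reflexive (sym nC2)))
  n≤ : (2 + m) C 2 ≤ 2 * δ + 2 * 2 * (2 + m)
  n≤ = begin
    (2 + m) C 2                       ≡⟨ nC2 ⟩
    suc m + (m + m C 2)               ≤⟨ ℕ.+-monoʳ-≤ (suc m) (ℕ.+-monoʳ-≤ m upper) ⟩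
    suc m + (m + (2 * δ + 2 * m))     ≡⟨ rearrange m (2 * δ) ⟩
    2 * δ + (1 + 4 * m)               ≤⟨ ℕ.+-monoʳ-≤ (2 * δ) (ℕ.+-monoˡ-≤ (4 * m) (s≤s (z≤n {7}))) ⟩
    2 * δ + (8 + 4 * m)               ≡⟨ cong (2 * δ +_) (expand m) ⟩
    2 * δ + 2 * 2 * (2 + m)           ∎
    where
    rearrange : ∀ x d → suc x + (x + (d + 2 * x)) ≡ d + (1 + 4 * x)
    rearrange = solve-∀
    expand : ∀ x → 8 + 4 * x ≡ 2 * 2 * suc (suc x)
    expand = solve-∀

lemma1p1 : Σ ℕ λ K → 0 < K × (∀ (n : ℕ) → 1 ≤ n →
    Σ (ThreeGraph n) λ G → Σ ℕ λ δ → IsMinDegree G δ ×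
    (2 * δ ≤ (n C 2) + 2 * K * n) × ((n C 2) ≤ 2 * δ + 2 * K * n) ×
    ¬ HasSpanningComponent G)
lemma1p1 = 2 , s≤s z≤n , λ where
  (suc zero) _ →
    let G = Construction.G {0} (λ ()) in
    G , 0 , isMinDegree-attained G zero (λ _ → z≤n) refl , z≤n , z≤n , no-spanning-on-one-vertex G
  (suc (suc m)) _ →
    let (G , δ , δ-min , lower , upper , ¬spanning) = construction-on m
        (lower′ , upper′) = within-linear-window m δ lower upper
    in G , δ , δ-min , lower′ , upper′ , ¬spanning
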